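{- In every BZ algebra and in every BCC algebra, (Ex) holds if and only if (BB) holds.
   Context: An algebra $(A,\to,1)$ of type $(2,0)$ is a BZ algebra if it satisfies (Re), (M), (B), (An); it is a BCC algebra if it satisfies (Re), (M), (L), (B), (An). Properties, for all $x,y,z\in A$: (Re) $x\to x=1$; (M) $1\to x=x$; (L) $x\to 1=1$; (B) $(y\to z)\to[(x\to y)\to(x\to z)]=1$; (An) $x\to y=1=y\to x\Rightarrow x=y$; (Ex) $x\to(y\to z)=y\to(x\to z)$; (BB) $(y\to z)\to[(z\to x)\to(y\to x)]=1$. -}

module Defs where

open import Level using (Level; suc; _⊔_)
open import Relation.Binary.PropositionalEquality using (_≡_)

record Algebra20 (a : Level) : Set (suc a) where
  field
    Carrier : Set a
    _⇒_     : Carrier → Carrier → Carrier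
    𝟙       : Carrier
  infixr 5 _⇒_

module _ {a : Level} (𝔄 : Algebra20 a) where
  open Algebra20 𝔄

  Re : Set a
  Re = ∀ x → x ⇒ x ≡ 𝟙

  M : Set a
  M = ∀ x → 𝟙 ⇒ x ≡ x

  L : Set a
  L = ∀ x → x ⇒ 𝟙 ≡ 𝟙

  B : Set a
  B = ∀ x y z → (y ⇒ z) ⇒ ((x ⇒ y) ⇒ (x ⇒ z)) ≡ 𝟙

  An : Set a
  An = ∀ x y → x ⇒ y ≡ 𝟙 → y ⇒ x ≡ 𝟙 → x ≡ y

  Ex : Set a
  Ex = ∀ x y z → x ⇒ (y ⇒ z) ≡ y ⇒ (x ⇒ z)

  BB : Set a
  BB = ∀ x y z → (y ⇒ z) ⇒ ((z ⇒ x) ⇒ (y ⇒ x)) ≡ 𝟙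

  record IsBZ : Set a where
    field
      re : Re
      m  : M
      b  : B
      an : An

  record IsBCC : Set a where
    field
      re : Re
      m  : M
      l  : L
      b  : B
      an : An

-- Ex turns BB into an instance of B. Conversely, write x ≤ y for x ⇒ y = 1: with M,
-- B makes ≤ transitive, and BB makes x ⇒ z antitone in x and gives
-- y ≤ (y ⇒ z) ⇒ z; chaining these yields x ⇒ (y ⇒ z) ≤ y ⇒ (x ⇒ z) for all x, y,
-- and An turns the two symmetric instances into Ex.
module Submission where

open import Defs
open import Level using (Level)
open import Data.Product using (_×_; _,_)
open import Function.Bundles using (_⇔_; mk⇔)
open import Relation.Binary.PropositionalEquality using (_≡_; refl; sym; trans; cong; subst; module ≡-Reasoning)

module _ {a : Level} (𝔄 : Algebra20 a) where
  open Algebra20 𝔄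

  infix 4 _≤_
  _≤_ : Carrier → Carrier → Set a
  x ≤ y = x ⇒ y ≡ 𝟙

  Ex∧B⇒BB : Ex 𝔄 → B 𝔄 → BB 𝔄
  Ex∧B⇒BB ex b x y z = trans (ex (y ⇒ z) (z ⇒ x) (y ⇒ x)) (b y z x)

  module _ (m : M 𝔄) where

    modus-ponens : ∀ {x y} → x ≡ 𝟙 → x ≤ y → y ≡ 𝟙
    modus-ponens {x} {y} x≡𝟙 x≤y = begin
      y      ≡⟨ sym (m y) ⟩
      𝟙 ⇒ y  ≡⟨ cong (_⇒ y) (sym x≡𝟙) ⟩
      x ⇒ y  ≡⟨ x≤y ⟩
      𝟙      ∎
      where open ≡-Reasoning

    B⇒≤-trans : B 𝔄 → ∀ {x y z} → x ≤ y → y ≤ z → x ≤ z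
    B⇒≤-trans b {x} {y} {z} x≤y y≤z =
      modus-ponens x≤y (modus-ponens y≤z (b x y z))

    module _ (bb : BB 𝔄) where

      BB⇒⇒-antitoneˡ : ∀ {x y} z → x ≤ y → y ⇒ z ≤ x ⇒ z
      BB⇒⇒-antitoneˡ {x} {y} z x≤y = modus-ponens x≤y (bb z x y)

      BB⇒x≤[x⇒z]⇒z : ∀ x z → x ≤ (x ⇒ z) ⇒ z
      BB⇒x≤[x⇒z]⇒z x z = subst (_≡ 𝟙) eq (bb z 𝟙 x)
        where
        eq : (𝟙 ⇒ x) ⇒ ((x ⇒ z) ⇒ (𝟙 ⇒ z)) ≡ x ⇒ ((x ⇒ z) ⇒ z)
        eq rewrite m x | m z = refl

      BB⇒exchange-≤ : B 𝔄 → ∀ x y z → x ⇒ (y ⇒ z) ≤ y ⇒ (x ⇒ z)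
      BB⇒exchange-≤ b x y z =
        B⇒≤-trans b (bb z x (y ⇒ z)) (BB⇒⇒-antitoneˡ (x ⇒ z) (BB⇒x≤[x⇒z]⇒z y z))

      BB⇒Ex : B 𝔄 → An 𝔄 → Ex 𝔄
      BB⇒Ex b an x y z = an _ _ (BB⇒exchange-≤ b x y z) (BB⇒exchange-≤ b y x z)

  IsBZ⇒Ex⇔BB : IsBZ 𝔄 → Ex 𝔄 ⇔ BB 𝔄
  IsBZ⇒Ex⇔BB isBZ = mk⇔ (λ ex → Ex∧B⇒BB ex b) (λ bb → BB⇒Ex m bb b an)
    where open IsBZ isBZ

  IsBCC⇒IsBZ : IsBCC 𝔄 → IsBZ 𝔄
  IsBCC⇒IsBZ isBCC = record { re = re ; m = m ; b = b ; an = an }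
    where open IsBCC isBCC

corollary2p5 : ∀ {a : Level} → ((𝔄 : Algebra20 a) → IsBZ 𝔄 → (Ex 𝔄 ⇔ BB 𝔄))
    × ((𝔄 : Algebra20 a) → IsBCC 𝔄 → (Ex 𝔄 ⇔ BB 𝔄))
corollary2p5 = IsBZ⇒Ex⇔BB , λ 𝔄 isBCC → IsBZ⇒Ex⇔BB 𝔄 (IsBCC⇒IsBZ 𝔄 isBCC)
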